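{- Let $G$ be a graph, let $\overrightarrow{G}$ be any orientation of $G$, let $n\ge 1$, and let $\overrightarrow{K}_{1,n}^l$ be any orientation of $K_{1,n}^l$. For $1\le r\le n+1$ let $f_r$ be the super edge-magic labeling of $K_{1,n}^l$ which assigns the label $r$ to the central vertex (its vertices receive the labels $[1,n+1]$). Let $g$ be a (super) edge-magic labeling of $G$, and let $\widehat{g}_r$ be the labeling of $\mathrm{und}(\overrightarrow{G}\otimes\overrightarrow{K}_{1,n}^l)$ induced by $g$ and $f_r$ (as defined in the context). Then: (i) $\widehat{g}_r$ has valence $\mathrm{val}(\widehat{g}_r)=(n+1)(\mathrm{val}(g)-2)+r+1$; (ii) if $g'$ is another (super) edge-magic labeling of $G$ with $\mathrm{val}(g)<\mathrm{val}(g')$, and $\widehat{g}'_r$ denotes the labeling induced by $g'$ and $f_r$, then $\mathrm{val}(\widehat{g}_{n+1})<\mathrm{val}(\widehat{g}'_1)$.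
   Context: Graphs may have loops and multiple edges. A $(p,q)$-graph has $p$ vertices and $q$ edges; $[a,b]=\{a,a+1,\dots,b\}$. An edge-magic labeling of a $(p,q)$-graph $G$ is a bijection $f:V(G)\cup E(G)\to[1,p+q]$ such that $f(x)+f(xy)+f(y)$ equals a constant $\mathrm{val}(f)$ (the valence) for every edge $xy$ (for a loop $e$ at $x$ the sum is $2f(x)+f(e)$). It is super edge-magic if moreover $f(V(G))=[1,p]$. A digraph admits a labeling if its underlying graph (written $\mathrm{und}$) does. $K_{1,n}^l$ is the star $K_{1,n}$ with a loop attached at its central vertex. For digraphs $D,F$, $D\otimes F$ is the digraph with vertex set $V(D)\times V(F)$ and arc $((a,i),(b,j))$ iff $(a,b)\in E(D)$ and $(i,j)\in E(F)$ (loops count as arcs $(x,x)$). Induced labeling: identify each vertex of $G$ with its label under $g$ and each vertex of $K_{1,n}^l$ with its label under $f_r$; put $P=n+1$ and $k=r+1$ (the minimum of $f_r(u)+f_r(v)$ over edges $uv$ of $K_{1,n}^l$). Then $\widehat{g}_r$ assigns to the vertex $(a,i)$ the label $P(a-1)+i$ and to the arc $((a,i),(b,j))$ coming from the arc $(a,b)$ of $\overrightarrow{G}$ with $g$-label $e$ the label $P(e-1)+(k+P)-(i+j)$. -}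

module Defs where

open import Data.Nat using (ℕ; zero; suc; _+_; _*_; _∸_; _≤_; _<_)
open import Data.Fin using (Fin; zero; suc)
open import Data.Bool using (Bool; true; false)
open import Data.Sum using (_⊎_; inj₁; inj₂)
open import Data.Product using (_×_; _,_; Σ; ∃)
open import Relation.Binary.PropositionalEquality using (_≡_)
open import Function.Definitions using (Injective)

-- An oriented graph is represented by its arcs; the underlying graph
-- und(D) has the same vertices and one edge {tail e, head e} per arc e
-- (a loop when tail e ≡ head e).
record Digraph : Set where
  field
    p    : ℕ
    q    : ℕ
    tail : Fin q → Fin p
    head : Fin q → Fin p
open Digraph public

edgeSum : (D : Digraph) → (Fin (p D) → ℕ) → (Fin (q D) → ℕ) → Fin (q D) → ℕ
edgeSum D fv fe e = fv (tail D e) + fe e + fv (head D e)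

joint : (D : Digraph) → (Fin (p D) → ℕ) → (Fin (q D) → ℕ) → Fin (p D) ⊎ Fin (q D) → ℕ
joint D fv fe (inj₁ v) = fv v
joint D fv fe (inj₂ e) = fe e

IsBijLabeling : (D : Digraph) → (Fin (p D) → ℕ) → (Fin (q D) → ℕ) → Set
IsBijLabeling D fv fe =
  Injective _≡_ _≡_ (joint D fv fe)
  × (∀ x → 1 ≤ joint D fv fe x × joint D fv fe x ≤ p D + q D)
  × (∀ m → 1 ≤ m → m ≤ p D + q D → ∃ λ x → joint D fv fe x ≡ m)

IsEdgeMagic : (D : Digraph) → (Fin (p D) → ℕ) → (Fin (q D) → ℕ) → ℕ → Set
IsEdgeMagic D fv fe val =
  IsBijLabeling D fv fe × (∀ e → edgeSum D fv fe e ≡ val)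

IsSuperEdgeMagic : (D : Digraph) → (Fin (p D) → ℕ) → (Fin (q D) → ℕ) → ℕ → Set
IsSuperEdgeMagic D fv fe val =
  IsEdgeMagic D fv fe val × (∀ v → fv v ≤ p D)

-- An orientation of K_{1,n}^l: vertex zero is the centre, vertex suc i a leaf;
-- arc zero is the loop at the centre, arc suc i joins the centre and leaf suc i,
-- oriented centre → leaf iff dir i ≡ true.
starTail : (n : ℕ) → (Fin n → Bool) → Fin (suc n) → Fin (suc n)
starTail n dir zero = zero
starTail n dir (suc i) with dir i
... | true  = zero
... | false = suc i

starHead : (n : ℕ) → (Fin n → Bool) → Fin (suc n) → Fin (suc n)
starHead n dir zero = zero
starHead n dir (suc i) with dir i
... | true  = suc i
... | false = zero

Star : (n : ℕ) → (Fin n → Bool) → Digraph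
Star n dir = record { p = suc n ; q = suc n ; tail = starTail n dir ; head = starHead n dir }

IsFr : (n : ℕ) (dir : Fin n → Bool) (r : ℕ) → (Fin (suc n) → ℕ) → Set
IsFr n dir r fv =
  Σ (Fin (suc n) → ℕ) λ fe → Σ ℕ λ val →
    IsSuperEdgeMagic (Star n dir) fv fe val × fv zero ≡ r

-- The product G ⊗ K (K the oriented K_{1,n}^l): vertices are pairs (a , i),
-- arcs are pairs (e , e') of an arc e : a → b of G and an arc e' : i → j of K,
-- giving the arc ((a,i),(b,j)).
hatV : (n : ℕ) (G : Digraph) → (Fin (p G) → ℕ) → (Fin (suc n) → ℕ) →
       Fin (p G) × Fin (suc n) → ℕ
hatV n G gv fv (a , i) = suc n * (gv a ∸ 1) + fv i

hatE : (n : ℕ) (dir : Fin n → Bool) (G : Digraph) (r : ℕ) →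
       (Fin (q G) → ℕ) → (Fin (suc n) → ℕ) → Fin (q G) × Fin (suc n) → ℕ
hatE n dir G r ge fv (e , e') =
  suc n * (ge e ∸ 1) + ((suc r + suc n) ∸ (fv (starTail n dir e') + fv (starHead n dir e')))

hatSum : (n : ℕ) (dir : Fin n → Bool) (G : Digraph) (r : ℕ) →
         (Fin (p G) → ℕ) → (Fin (q G) → ℕ) → (Fin (suc n) → ℕ) →
         Fin (q G) × Fin (suc n) → ℕ
hatSum n dir G r gv ge fv (e , e') =
  hatV n G gv fv (tail G e , starTail n dir e')
  + hatE n dir G r ge fv (e , e')
  + hatV n G gv fv (head G e , starHead n dir e')

module Submission where

-- Write P = n+1.  Every arc ((a,i),(b,j)) of G ⊗ K_{1,n}^l
-- comes from an arc e : a → b of G and an arc i → j of the star; its edge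
-- sum under ĝ_r splits into a "block" part P(g(a)-1) + P(g(e)-1) + P(g(b)-1)
-- and an "offset" part f_r(i) + ((r+1+P) - (f_r(i)+f_r(j))) + f_r(j).
--   * Every arc of the star is incident with the centre (label r) and the
--     other labels are at most P, so f_r(i) + f_r(j) ≤ r + 1 + P and the
--     truncated subtraction is exact: the offset part is r + 1 + P.
--   * Labels of g are positive, so the block part plus the extra P is
--     P(g(a) + g(e) + g(b) - 2) = P(val(g) - 2).
-- This gives (i).  For (ii), labels are positive so val(g) ≥ 2, hence
-- val(g) < val(g') yields val(g) - 2 < val(g') - 2, and then
-- P(val(g)-2) + P + 1 < P(val(g')-2) + 1 + 1, which by (i) is the claim.

open import Defs
open import Data.Nat using (ℕ; suc; _+_; _*_; _∸_; _≤_; _<_)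
open import Data.Fin using (Fin)
open import Data.Bool using (Bool)
open import Data.Product using (_×_; _,_)
open import Relation.Binary.PropositionalEquality using (_≡_)

open import Data.Nat using (s≤s; z≤n)
open import Data.Fin using (zero; suc)
open import Data.Bool using (true; false)
open import Data.Sum using (inj₁; inj₂)
open import Data.Product using (proj₁; ∃-syntax)
open import Data.Nat.Properties
open import Relation.Binary.PropositionalEquality
  using (refl; sym; cong; subst₂; module ≡-Reasoning)
open import Data.Nat.Solver using (module +-*-Solver)
open +-*-Solver using (solve; _:+_; _:*_; _:=_; con)

vertexLabel≥1 : (D : Digraph) (fv : Fin (p D) → ℕ) (fe : Fin (q D) → ℕ) →
  IsBijLabeling D fv fe → ∀ v → 1 ≤ fv v
vertexLabel≥1 D fv fe (_ , bounds , _) v = proj₁ (bounds (inj₁ v))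

edgeLabel≥1 : (D : Digraph) (fv : Fin (p D) → ℕ) (fe : Fin (q D) → ℕ) →
  IsBijLabeling D fv fe → ∀ e → 1 ≤ fe e
edgeLabel≥1 D fv fe (_ , bounds , _) e = proj₁ (bounds (inj₂ e))

-- The valence of an edge-magic labeling of a graph with at least one edge is
-- at least 2 (it is a sum of positive labels); needed to cancel the "- 2".
valence≥2 : (D : Digraph) (fv : Fin (p D) → ℕ) (fe : Fin (q D) → ℕ) (val : ℕ) →
  IsEdgeMagic D fv fe val → Fin (q D) → 2 ≤ val
valence≥2 D fv fe val (bij , magic) e = begin
  2                                     ≤⟨ +-mono-≤ (vertexLabel≥1 D fv fe bij (tail D e))
                                                    (edgeLabel≥1 D fv fe bij e) ⟩
  fv (tail D e) + fe e                  ≤⟨ m≤m+n _ _ ⟩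
  fv (tail D e) + fe e + fv (head D e)  ≡⟨ magic e ⟩
  val                                   ∎
  where open ≤-Reasoning

starArcThroughCentre : (n : ℕ) (dir : Fin n → Bool) (fv : Fin (suc n) → ℕ) (e' : Fin (suc n)) →
  ∃[ v ] fv (starTail n dir e') + fv (starHead n dir e') ≡ fv zero + fv v
starArcThroughCentre n dir fv zero = zero , refl
starArcThroughCentre n dir fv (suc i) with dir i
... | true  = suc i , refl
... | false = suc i , +-comm (fv (suc i)) (fv zero)

-- For f_r (centre r, all labels ≤ n+1) the endpoint sum of any star arc is at
-- most r + (n+1); this makes the subtraction in the arc label of ĝ_r exact.
starEndpointSum≤ : (n : ℕ) (dir : Fin n → Bool) (r : ℕ) (fv : Fin (suc n) → ℕ) →
  IsFr n dir r fv → ∀ e' → fv (starTail n dir e') + fv (starHead n dir e') ≤ r + suc n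
starEndpointSum≤ n dir r fv (_ , _ , (_ , super) , centre) e'
  with starArcThroughCentre n dir fv e'
... | v , split = begin
  fv (starTail n dir e') + fv (starHead n dir e')  ≡⟨ split ⟩
  fv zero + fv v                                   ≡⟨ cong (_+ fv v) centre ⟩
  r + fv v                                         ≤⟨ +-monoʳ-≤ r (super v) ⟩
  r + suc n                                        ∎
  where open ≤-Reasoning

inducedSumIdentity : (P a e b x y r : ℕ) → 1 ≤ a → 1 ≤ e → 1 ≤ b → x + y ≤ suc r + P →
  P * (a ∸ 1) + x + (P * (e ∸ 1) + (suc r + P ∸ (x + y))) + (P * (b ∸ 1) + y)
    ≡ P * (a + e + b ∸ 2) + r + 1
inducedSumIdentity P (suc a) (suc e) (suc b) x y r _ _ _ x+y≤ = begin
    P * a + x + (P * e + d) + (P * b + y)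
  ≡⟨ solve 7 (λ P a e b x y d → P :* a :+ x :+ (P :* e :+ d) :+ (P :* b :+ y)
        := (P :* a :+ P :* e :+ P :* b) :+ (d :+ (x :+ y))) refl P a e b x y d ⟩
    (P * a + P * e + P * b) + (d + (x + y))
  ≡⟨ cong ((P * a + P * e + P * b) +_) (m∸n+n≡m x+y≤) ⟩
    (P * a + P * e + P * b) + (suc r + P)
  ≡⟨ solve 5 (λ P a e b r → (P :* a :+ P :* e :+ P :* b) :+ (con 1 :+ r :+ P)
        := P :* (a :+ e :+ b :+ con 1) :+ r :+ con 1) refl P a e b r ⟩
    P * (a + e + b + 1) + r + 1
  ≡⟨ cong (λ s → P * s + r + 1) (sym (dropTwo a e b)) ⟩
    P * (suc a + suc e + suc b ∸ 2) + r + 1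
  ∎
  where
    open ≡-Reasoning
    d : ℕ
    d = suc r + P ∸ (x + y)
    dropTwo : ∀ a e b → suc a + suc e + suc b ∸ 2 ≡ a + e + b + 1
    dropTwo a e b rewrite +-suc a e | +-suc (a + e) b = +-comm 1 (a + e + b)

inducedValence : (G : Digraph) (n : ℕ) (dir : Fin n → Bool) →
  (gv : Fin (p G) → ℕ) (ge : Fin (q G) → ℕ) (valg : ℕ) → IsEdgeMagic G gv ge valg →
  (r : ℕ) → 1 ≤ r → r ≤ suc n → (fv : Fin (suc n) → ℕ) → IsFr n dir r fv →
  ∀ e e' → hatSum n dir G r gv ge fv (e , e') ≡ suc n * (valg ∸ 2) + r + 1
inducedValence G n dir gv ge valg (bij , magic) r _ _ fv isFr e e' = begin
    hatSum n dir G r gv ge fv (e , e')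
  ≡⟨ inducedSumIdentity (suc n) (gv (tail G e)) (ge e) (gv (head G e)) _ _ r
       (vertexLabel≥1 G gv ge bij (tail G e)) (edgeLabel≥1 G gv ge bij e)
       (vertexLabel≥1 G gv ge bij (head G e))
       (≤-trans (starEndpointSum≤ n dir r fv isFr e') (n≤1+n _)) ⟩
    suc n * (edgeSum G gv ge e ∸ 2) + r + 1
  ≡⟨ cong (λ s → suc n * (s ∸ 2) + r + 1) (magic e) ⟩
    suc n * (valg ∸ 2) + r + 1
  ∎
  where open ≡-Reasoning

-- Comparison of the two extreme valences: if u < w then the valence with
-- centre label P is below the valence with centre label 1, i.e.
-- P·u + P + 1 < P·w + 1 + 1.
extremeValences< : (P u w : ℕ) → u < w → P * u + P + 1 < P * w + 1 + 1
extremeValences< P u w u<w = begin-strict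
  P * u + P + 1     <⟨ m<m+n _ ≤-refl ⟩
  P * u + P + 1 + 1 ≡⟨ cong (_+ 1) (solve 2 (λ P u → P :* u :+ P :+ con 1
                                            := P :* (con 1 :+ u) :+ con 1) refl P u) ⟩
  P * suc u + 1 + 1 ≤⟨ +-monoˡ-≤ 1 (+-monoˡ-≤ 1 (*-monoʳ-≤ P u<w)) ⟩
  P * w + 1 + 1     ∎
  where open ≤-Reasoning

lemma2p1 : (G : Digraph) (n : ℕ) → 1 ≤ n → (dir : Fin n → Bool) →
    ((gv : Fin (p G) → ℕ) (ge : Fin (q G) → ℕ) (valg : ℕ) → IsEdgeMagic G gv ge valg →
    (r : ℕ) → 1 ≤ r → r ≤ suc n → (fv : Fin (suc n) → ℕ) → IsFr n dir r fv →
    ∀ e e' → hatSum n dir G r gv ge fv (e , e') ≡ suc n * (valg ∸ 2) + r + 1)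
    ×
    ((gv : Fin (p G) → ℕ) (ge : Fin (q G) → ℕ) (valg : ℕ) → IsEdgeMagic G gv ge valg →
    (gv' : Fin (p G) → ℕ) (ge' : Fin (q G) → ℕ) (valg' : ℕ) → IsEdgeMagic G gv' ge' valg' →
    valg < valg' →
    (f1 : Fin (suc n) → ℕ) → IsFr n dir 1 f1 →
    (fN : Fin (suc n) → ℕ) → IsFr n dir (suc n) fN →
    ∀ x y → hatSum n dir G (suc n) gv ge fN x < hatSum n dir G 1 gv' ge' f1 y)
lemma2p1 G n _ dir = inducedValence G n dir , valencesOrdered
  where
    valencesOrdered : (gv : Fin (p G) → ℕ) (ge : Fin (q G) → ℕ) (valg : ℕ) → IsEdgeMagic G gv ge valg →
      (gv' : Fin (p G) → ℕ) (ge' : Fin (q G) → ℕ) (valg' : ℕ) → IsEdgeMagic G gv' ge' valg' →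
      valg < valg' →
      (f1 : Fin (suc n) → ℕ) → IsFr n dir 1 f1 →
      (fN : Fin (suc n) → ℕ) → IsFr n dir (suc n) fN →
      ∀ x y → hatSum n dir G (suc n) gv ge fN x < hatSum n dir G 1 gv' ge' f1 y
    valencesOrdered gv ge valg magic gv' ge' valg' magic' valg<valg' f1 isF1 fN isFN (e , e') (d , d') =
      subst₂ _<_
        (sym (inducedValence G n dir gv ge valg magic (suc n) (s≤s z≤n) ≤-refl fN isFN e e'))
        (sym (inducedValence G n dir gv' ge' valg' magic' 1 ≤-refl (s≤s z≤n) f1 isF1 d d'))
        (extremeValences< (suc n) (valg ∸ 2) (valg' ∸ 2)
          (∸-monoˡ-< valg<valg' (valence≥2 G gv ge valg magic e)))
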